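{- For any two connected graphs $G_1$ and $G_2$, $fix(G_1+G_2)\geq fix(G_1)+fix(G_2)$, where $G_1+G_2$ denotes the join. This bound is sharp.
   Context: All graphs are finite, simple; throughout the paper graphs are assumed connected and symmetric (having a nontrivial automorphism group). A set $F\subseteq V(G)$ is a fixing set of $G$ if the only automorphism of $G$ fixing every vertex of $F$ is the identity; $fix(G)$ is the minimum cardinality of a fixing set. The join $G_1+G_2$ of graphs with disjoint vertex sets is the union $G_1\cup G_2$ together with all edges joining every vertex of $G_1$ to every vertex of $G_2$. -}

module Defs where

open import Data.Nat using (ℕ; _+_)
open import Data.Bool using (Bool; true; false)
open import Data.Fin using (Fin; splitAt)
open import Data.Fin.Subset using (Subset; _∈_; ∣_∣)
open import Data.Fin.Permutation using (Permutation′; _⟨$⟩ʳ_)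
open import Data.Sum using (_⊎_; inj₁; inj₂)
open import Data.Product using (Σ; ∃; _×_; _,_)
open import Relation.Binary.PropositionalEquality using (_≡_; refl)
open import Relation.Nullary using (¬_)

record Graph (n : ℕ) : Set where
  field
    adj    : Fin n → Fin n → Bool
    sym    : ∀ i j → adj i j ≡ adj j i
    irrefl : ∀ i → adj i i ≡ false
open Graph public

data Walk {n : ℕ} (G : Graph n) : Fin n → Fin n → Set where
  here : ∀ {i} → Walk G i i
  step : ∀ {i j k} → adj G i j ≡ true → Walk G j k → Walk G i k

Connected : ∀ {n} → Graph n → Set
Connected G = ∀ i j → Walk G i j

IsAutomorphism : ∀ {n} → Graph n → Permutation′ n → Set
IsAutomorphism G σ = ∀ i j → adj G (σ ⟨$⟩ʳ i) (σ ⟨$⟩ʳ j) ≡ adj G i j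

IsIdentity : ∀ {n} → Permutation′ n → Set
IsIdentity σ = ∀ i → σ ⟨$⟩ʳ i ≡ i

Symmetric : ∀ {n} → Graph n → Set
Symmetric G = Σ _ λ σ → IsAutomorphism G σ × ¬ IsIdentity σ

IsFixingSet : ∀ {n} → Graph n → Subset n → Set
IsFixingSet G F = ∀ σ → IsAutomorphism G σ →
  (∀ i → i ∈ F → σ ⟨$⟩ʳ i ≡ i) → IsIdentity σ

IsFixNumber : ∀ {n} → Graph n → ℕ → Set
IsFixNumber G k =
  (Σ _ λ F → IsFixingSet G F × ∣ F ∣ ≡ k) ×
  (∀ F → IsFixingSet G F → k Data.Nat.≤ ∣ F ∣)

joinAdj : ∀ {n₁ n₂} → Graph n₁ → Graph n₂ → Fin (n₁ + n₂) → Fin (n₁ + n₂) → Bool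
joinAdj {n₁} G₁ G₂ i j with splitAt n₁ i | splitAt n₁ j
... | inj₁ a | inj₁ b = adj G₁ a b
... | inj₂ a | inj₂ b = adj G₂ a b
... | inj₁ _ | inj₂ _ = true
... | inj₂ _ | inj₁ _ = true

joinSym : ∀ {n₁ n₂} (G₁ : Graph n₁) (G₂ : Graph n₂) i j →
  joinAdj G₁ G₂ i j ≡ joinAdj G₁ G₂ j i
joinSym {n₁} G₁ G₂ i j with splitAt n₁ i | splitAt n₁ j
... | inj₁ a | inj₁ b = sym G₁ a b
... | inj₂ a | inj₂ b = sym G₂ a b
... | inj₁ _ | inj₂ _ = refl
... | inj₂ _ | inj₁ _ = refl

joinIrrefl : ∀ {n₁ n₂} (G₁ : Graph n₁) (G₂ : Graph n₂) i →
  joinAdj G₁ G₂ i i ≡ false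
joinIrrefl {n₁} G₁ G₂ i with splitAt n₁ i
... | inj₁ a = irrefl G₁ a
... | inj₂ a = irrefl G₂ a

join : ∀ {n₁ n₂} → Graph n₁ → Graph n₂ → Graph (n₁ + n₂)
join G₁ G₂ = record
  { adj = joinAdj G₁ G₂ ; sym = joinSym G₁ G₂ ; irrefl = joinIrrefl G₁ G₂ }

module Submission where

-- Automorphisms σ of G₁ and τ of G₂ combine into an automorphism
-- σ ⊕ τ of the join.  Write a fixing set of the join as F₁ ++ F₂.  If σ fixes
-- F₁ pointwise, then σ ⊕ id fixes F₁ ++ F₂, so it is the identity and so is σ:
-- F₁ is a fixing set of G₁, and likewise F₂ of G₂.  Hence
-- fix(G₁) + fix(G₂) ≤ ∣F₁∣ + ∣F₂∣ = ∣F₁ ++ F₂∣.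
--
-- If degrees in the join separate the two sides, every automorphism
-- of the join maps each side onto itself, hence restricts to automorphisms of
-- G₁ and G₂; so fixing sets F₁ of G₁ and F₂ of G₂ give the fixing set F₁ ++ F₂
-- of the join.  For K₂ and the path P₄ this gives a fixing set of K₂ + P₄ of
-- size 1 + 1, while every fixing set of a symmetric graph is nonempty; together
-- with the lower bound, fix(K₂ + P₄) = 2 = fix(K₂) + fix(P₄).

open import Defs
  using (Graph; adj; Walk; here; step; Connected; IsAutomorphism; IsIdentity;
         Symmetric; IsFixingSet; IsFixNumber; join)
open import Data.Bool using (Bool; true; false; if_then_else_; _∨_)
import Data.Bool as Bool
open import Data.Bool.Properties using (∨-comm)
open import Data.Empty using (⊥-elim)
open import Data.Fin using (Fin; toℕ; splitAt; _↑ˡ_; _↑ʳ_)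
open import Data.Fin.Patterns using (0F; 1F; 2F; 3F)
open import Data.Fin.Permutation
  using (Permutation′; _⟨$⟩ʳ_; _⟨$⟩ˡ_; permutation; inverseˡ; inverseʳ; reverse)
import Data.Fin.Permutation as Permutation
open import Data.Fin.Properties
  using (all?; +↔⊎; splitAt-↑ˡ; splitAt-↑ʳ; splitAt⁻¹-↑ˡ; splitAt⁻¹-↑ʳ; ↑ˡ-injective; ↑ʳ-injective)
open import Data.Fin.Subset using (Subset; _∈_; ∣_∣; inside; outside; ⁅_⁆)
open import Data.Fin.Subset.Properties using (∣p∣≤∣x∷p∣)
open import Data.Nat using (ℕ; _+_; _≤_; suc; zero; z≤n; s≤s; _≡ᵇ_)
import Data.Nat as ℕ
open import Data.Nat.Properties using (+-0-commutativeMonoid; +-mono-≤; ≤-trans; n≢0⇒n>0)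
open import Algebra.Properties.CommutativeMonoid.Sum +-0-commutativeMonoid
  using (sum; sum-permute; sum-cong-≗)
open import Data.Product using (Σ; ∃; _×_; _,_; proj₁; proj₂)
open import Data.Sum using (inj₁; inj₂)
open import Data.Sum.Function.Propositional using (_⊎-↔_)
open import Data.Vec using ([]; _∷_; _++_; here; there)
import Data.Vec as Vec
open import Data.Vec.Properties using (lookup-++ˡ; lookup-++ʳ; []=⇒lookup; lookup⇒[]=)
open import Function using (case_of_)
open import Function.Construct.Composition using (_↔-∘_)
open import Function.Construct.Symmetry using (↔-sym)
open import Relation.Nullary using (Dec; ¬?)
open import Relation.Nullary.Decidable using (from-yes)
open import Relation.Binary.PropositionalEquality
  using (_≡_; _≢_; refl; sym; trans; cong; cong₂; subst; module ≡-Reasoning)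
open ≡-Reasoning

private
  variable
    m n n₁ n₂ : ℕ

⟨$⟩ʳ-injective : (π : Permutation′ n) {u v : Fin n} → π ⟨$⟩ʳ u ≡ π ⟨$⟩ʳ v → u ≡ v
⟨$⟩ʳ-injective π eq = trans (sym (inverseˡ π)) (trans (cong (π ⟨$⟩ˡ_) eq) (inverseˡ π))

∣++∣ : (F₁ : Subset n₁) (F₂ : Subset n₂) → ∣ F₁ ++ F₂ ∣ ≡ ∣ F₁ ∣ + ∣ F₂ ∣
∣++∣ []            F₂ = refl
∣++∣ (inside  ∷ F₁) F₂ = cong suc (∣++∣ F₁ F₂)
∣++∣ (outside ∷ F₁) F₂ = ∣++∣ F₁ F₂

module _ (F₁ : Subset n₁) (F₂ : Subset n₂) where

  ∈-++ˡ⁺ : ∀ {a} → a ∈ F₁ → a ↑ˡ n₂ ∈ F₁ ++ F₂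
  ∈-++ˡ⁺ {a} a∈F₁ = lookup⇒[]= (a ↑ˡ n₂) (F₁ ++ F₂)
    (trans (lookup-++ˡ F₁ F₂ a) ([]=⇒lookup a∈F₁))

  ∈-++ˡ⁻ : ∀ {a} → a ↑ˡ n₂ ∈ F₁ ++ F₂ → a ∈ F₁
  ∈-++ˡ⁻ {a} a∈F = lookup⇒[]= a F₁ (trans (sym (lookup-++ˡ F₁ F₂ a)) ([]=⇒lookup a∈F))

  ∈-++ʳ⁺ : ∀ {b} → b ∈ F₂ → n₁ ↑ʳ b ∈ F₁ ++ F₂
  ∈-++ʳ⁺ {b} b∈F₂ = lookup⇒[]= (n₁ ↑ʳ b) (F₁ ++ F₂)
    (trans (lookup-++ʳ F₁ F₂ b) ([]=⇒lookup b∈F₂))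

  ∈-++ʳ⁻ : ∀ {b} → n₁ ↑ʳ b ∈ F₁ ++ F₂ → b ∈ F₂
  ∈-++ʳ⁻ {b} b∈F = lookup⇒[]= b F₂ (trans (sym (lookup-++ʳ F₁ F₂ b)) ([]=⇒lookup b∈F))

∈⇒1≤∣p∣ : {F : Subset n} {i : Fin n} → i ∈ F → 1 ≤ ∣ F ∣
∈⇒1≤∣p∣ here                     = s≤s z≤n
∈⇒1≤∣p∣ {F = s ∷ F} (there i∈F) = ≤-trans (∈⇒1≤∣p∣ i∈F) (∣p∣≤∣x∷p∣ s F)

data Side (n₁ n₂ : ℕ) : Fin (n₁ + n₂) → Set where
  left  : (a : Fin n₁) → Side n₁ n₂ (a ↑ˡ n₂)
  right : (b : Fin n₂) → Side n₁ n₂ (n₁ ↑ʳ b)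

side : ∀ n₁ n₂ (i : Fin (n₁ + n₂)) → Side n₁ n₂ i
side n₁ n₂ i with splitAt n₁ i in eq
... | inj₁ a = subst (Side n₁ n₂) (splitAt⁻¹-↑ˡ eq) (left a)
... | inj₂ b = subst (Side n₁ n₂) (splitAt⁻¹-↑ʳ eq) (right b)

_⊕_ : Permutation′ n₁ → Permutation′ n₂ → Permutation′ (n₁ + n₂)
σ ⊕ τ = ↔-sym +↔⊎ ↔-∘ ((σ ⊎-↔ τ) ↔-∘ +↔⊎)

module _ (σ : Permutation′ n₁) (τ : Permutation′ n₂) where

  ⊕-left : ∀ a → (σ ⊕ τ) ⟨$⟩ʳ (a ↑ˡ n₂) ≡ (σ ⟨$⟩ʳ a) ↑ˡ n₂
  ⊕-left a rewrite splitAt-↑ˡ n₁ a n₂ = refl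

  ⊕-right : ∀ b → (σ ⊕ τ) ⟨$⟩ʳ (n₁ ↑ʳ b) ≡ n₁ ↑ʳ (τ ⟨$⟩ʳ b)
  ⊕-right b rewrite splitAt-↑ʳ n₁ n₂ b = refl

  ⊕-identityˡ : IsIdentity (σ ⊕ τ) → IsIdentity σ
  ⊕-identityˡ σ⊕τ-id a = ↑ˡ-injective n₂ _ _ (trans (sym (⊕-left a)) (σ⊕τ-id (a ↑ˡ n₂)))

  ⊕-identityʳ : IsIdentity (σ ⊕ τ) → IsIdentity τ
  ⊕-identityʳ σ⊕τ-id b = ↑ʳ-injective n₁ _ _ (trans (sym (⊕-right b)) (σ⊕τ-id (n₁ ↑ʳ b)))

  ⊕-fixes : (F₁ : Subset n₁) (F₂ : Subset n₂) →
    (∀ a → a ∈ F₁ → σ ⟨$⟩ʳ a ≡ a) → (∀ b → b ∈ F₂ → τ ⟨$⟩ʳ b ≡ b) →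
    ∀ i → i ∈ F₁ ++ F₂ → (σ ⊕ τ) ⟨$⟩ʳ i ≡ i
  ⊕-fixes F₁ F₂ σ-fixes τ-fixes i i∈F with side n₁ n₂ i
  ... | left a  = trans (⊕-left a) (cong (_↑ˡ n₂) (σ-fixes a (∈-++ˡ⁻ F₁ F₂ i∈F)))
  ... | right b = trans (⊕-right b) (cong (n₁ ↑ʳ_) (τ-fixes b (∈-++ʳ⁻ F₁ F₂ i∈F)))

module _ (G₁ : Graph n₁) (G₂ : Graph n₂) where

  private
    J : Graph (n₁ + n₂)
    J = join G₁ G₂

  join-adj-ll : ∀ a a′ → adj J (a ↑ˡ n₂) (a′ ↑ˡ n₂) ≡ adj G₁ a a′
  join-adj-ll a a′ rewrite splitAt-↑ˡ n₁ a n₂ | splitAt-↑ˡ n₁ a′ n₂ = refl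

  join-adj-lr : ∀ a b → adj J (a ↑ˡ n₂) (n₁ ↑ʳ b) ≡ true
  join-adj-lr a b rewrite splitAt-↑ˡ n₁ a n₂ | splitAt-↑ʳ n₁ n₂ b = refl

  join-adj-rl : ∀ b a → adj J (n₁ ↑ʳ b) (a ↑ˡ n₂) ≡ true
  join-adj-rl b a rewrite splitAt-↑ˡ n₁ a n₂ | splitAt-↑ʳ n₁ n₂ b = refl

  join-adj-rr : ∀ b b′ → adj J (n₁ ↑ʳ b) (n₁ ↑ʳ b′) ≡ adj G₂ b b′
  join-adj-rr b b′ rewrite splitAt-↑ʳ n₁ n₂ b | splitAt-↑ʳ n₁ n₂ b′ = refl

  ⊕-automorphism : (σ : Permutation′ n₁) (τ : Permutation′ n₂) →
    IsAutomorphism G₁ σ → IsAutomorphism G₂ τ → IsAutomorphism J (σ ⊕ τ)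
  ⊕-automorphism σ τ σ-aut τ-aut i j with side n₁ n₂ i | side n₁ n₂ j
  ... | left a | left a′ = begin
    adj J ((σ ⊕ τ) ⟨$⟩ʳ (a ↑ˡ n₂)) ((σ ⊕ τ) ⟨$⟩ʳ (a′ ↑ˡ n₂)) ≡⟨ cong₂ (adj J) (⊕-left σ τ a) (⊕-left σ τ a′) ⟩
    adj J ((σ ⟨$⟩ʳ a) ↑ˡ n₂) ((σ ⟨$⟩ʳ a′) ↑ˡ n₂)             ≡⟨ join-adj-ll _ _ ⟩
    adj G₁ (σ ⟨$⟩ʳ a) (σ ⟨$⟩ʳ a′)                            ≡⟨ σ-aut a a′ ⟩
    adj G₁ a a′                                              ≡⟨ join-adj-ll a a′ ⟨
    adj J (a ↑ˡ n₂) (a′ ↑ˡ n₂)                               ∎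
  ... | left a | right b = begin
    adj J ((σ ⊕ τ) ⟨$⟩ʳ (a ↑ˡ n₂)) ((σ ⊕ τ) ⟨$⟩ʳ (n₁ ↑ʳ b)) ≡⟨ cong₂ (adj J) (⊕-left σ τ a) (⊕-right σ τ b) ⟩
    adj J ((σ ⟨$⟩ʳ a) ↑ˡ n₂) (n₁ ↑ʳ (τ ⟨$⟩ʳ b))             ≡⟨ join-adj-lr _ _ ⟩
    true                                                    ≡⟨ join-adj-lr a b ⟨
    adj J (a ↑ˡ n₂) (n₁ ↑ʳ b)                               ∎
  ... | right b | left a = begin
    adj J ((σ ⊕ τ) ⟨$⟩ʳ (n₁ ↑ʳ b)) ((σ ⊕ τ) ⟨$⟩ʳ (a ↑ˡ n₂)) ≡⟨ cong₂ (adj J) (⊕-right σ τ b) (⊕-left σ τ a) ⟩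
    adj J (n₁ ↑ʳ (τ ⟨$⟩ʳ b)) ((σ ⟨$⟩ʳ a) ↑ˡ n₂)             ≡⟨ join-adj-rl _ _ ⟩
    true                                                    ≡⟨ join-adj-rl b a ⟨
    adj J (n₁ ↑ʳ b) (a ↑ˡ n₂)                               ∎
  ... | right b | right b′ = begin
    adj J ((σ ⊕ τ) ⟨$⟩ʳ (n₁ ↑ʳ b)) ((σ ⊕ τ) ⟨$⟩ʳ (n₁ ↑ʳ b′)) ≡⟨ cong₂ (adj J) (⊕-right σ τ b) (⊕-right σ τ b′) ⟩
    adj J (n₁ ↑ʳ (τ ⟨$⟩ʳ b)) (n₁ ↑ʳ (τ ⟨$⟩ʳ b′))             ≡⟨ join-adj-rr _ _ ⟩
    adj G₂ (τ ⟨$⟩ʳ b) (τ ⟨$⟩ʳ b′)                            ≡⟨ τ-aut b b′ ⟩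
    adj G₂ b b′                                              ≡⟨ join-adj-rr b b′ ⟨
    adj J (n₁ ↑ʳ b) (n₁ ↑ʳ b′)                               ∎

id-automorphism : (G : Graph n) → IsAutomorphism G Permutation.id
id-automorphism G i j = refl

module _ (G₁ : Graph n₁) (G₂ : Graph n₂) (F₁ : Subset n₁) (F₂ : Subset n₂)
         (fixes : IsFixingSet (join G₁ G₂) (F₁ ++ F₂)) where

  fixingSet-leftHalf : IsFixingSet G₁ F₁
  fixingSet-leftHalf σ σ-aut σ-fixes = ⊕-identityˡ σ Permutation.id
    (fixes (σ ⊕ Permutation.id)
      (⊕-automorphism G₁ G₂ σ Permutation.id σ-aut (id-automorphism G₂))
      (⊕-fixes σ Permutation.id F₁ F₂ σ-fixes (λ _ _ → refl)))

  fixingSet-rightHalf : IsFixingSet G₂ F₂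
  fixingSet-rightHalf τ τ-aut τ-fixes = ⊕-identityʳ Permutation.id τ
    (fixes (Permutation.id ⊕ τ)
      (⊕-automorphism G₁ G₂ Permutation.id τ (id-automorphism G₁) τ-aut)
      (⊕-fixes Permutation.id τ F₁ F₂ (λ _ _ → refl) τ-fixes))

join-fixingSet-lowerBound : (G₁ : Graph n₁) (G₂ : Graph n₂) {k₁ k₂ : ℕ} →
  IsFixNumber G₁ k₁ → IsFixNumber G₂ k₂ →
  ∀ F → IsFixingSet (join G₁ G₂) F → k₁ + k₂ ≤ ∣ F ∣
join-fixingSet-lowerBound {n₁} G₁ G₂ (_ , min₁) (_ , min₂) F fixes
  with F₁ , F₂ , refl ← Vec.splitAt n₁ F = subst (_ ≤_) (sym (∣++∣ F₁ F₂))
    (+-mono-≤ (min₁ F₁ (fixingSet-leftHalf G₁ G₂ F₁ F₂ fixes))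
              (min₂ F₂ (fixingSet-rightHalf G₁ G₂ F₁ F₂ fixes)))

Restricts : Permutation′ n → (Fin m → Fin n) → Permutation′ m → Set
Restricts π e σ = ∀ a → π ⟨$⟩ʳ e a ≡ e (σ ⟨$⟩ʳ a)

restriction : (π : Permutation′ n) (e : Fin m → Fin n) →
  (∀ {a a′} → e a ≡ e a′ → a ≡ a′) →
  (∀ a → ∃ λ a′ → π ⟨$⟩ʳ e a ≡ e a′) → (∀ a → ∃ λ a′ → π ⟨$⟩ˡ e a ≡ e a′) →
  Σ (Permutation′ m) λ σ → Restricts π e σ
restriction {m = m} π e e-injective forth back =
  permutation to from to∘from from∘to , λ a → proj₂ (forth a)
  where
  to from : Fin m → Fin m
  to   a = proj₁ (forth a)
  from a = proj₁ (back a)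

  to∘from : ∀ a → to (from a) ≡ a
  to∘from a = e-injective (begin
    e (to (from a))        ≡⟨ proj₂ (forth (from a)) ⟨
    π ⟨$⟩ʳ e (from a)      ≡⟨ cong (π ⟨$⟩ʳ_) (proj₂ (back a)) ⟨
    π ⟨$⟩ʳ (π ⟨$⟩ˡ e a)    ≡⟨ inverseʳ π ⟩
    e a                    ∎)

  from∘to : ∀ a → from (to a) ≡ a
  from∘to a = e-injective (begin
    e (from (to a))        ≡⟨ proj₂ (back (to a)) ⟨
    π ⟨$⟩ˡ e (to a)        ≡⟨ cong (π ⟨$⟩ˡ_) (proj₂ (forth a)) ⟨
    π ⟨$⟩ˡ (π ⟨$⟩ʳ e a)    ≡⟨ inverseˡ π ⟩
    e a                    ∎)

module _ (G : Graph m) (H : Graph n) (e : Fin m → Fin n)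
         (e-adj : ∀ a a′ → adj H (e a) (e a′) ≡ adj G a a′)
         (e-injective : ∀ {a a′} → e a ≡ e a′ → a ≡ a′) where

  restriction-automorphism : {π : Permutation′ n} {σ : Permutation′ m} →
    Restricts π e σ → IsAutomorphism H π → IsAutomorphism G σ
  restriction-automorphism {π} {σ} π↾σ π-aut a a′ = begin
    adj G (σ ⟨$⟩ʳ a) (σ ⟨$⟩ʳ a′)          ≡⟨ e-adj _ _ ⟨
    adj H (e (σ ⟨$⟩ʳ a)) (e (σ ⟨$⟩ʳ a′))  ≡⟨ cong₂ (adj H) (π↾σ a) (π↾σ a′) ⟨
    adj H (π ⟨$⟩ʳ e a) (π ⟨$⟩ʳ e a′)      ≡⟨ π-aut (e a) (e a′) ⟩
    adj H (e a) (e a′)                    ≡⟨ e-adj a a′ ⟩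
    adj G a a′                            ∎

  fixed-on-image : (π : Permutation′ n) → IsAutomorphism H π →
    (∀ a → ∃ λ a′ → π ⟨$⟩ʳ e a ≡ e a′) → (∀ a → ∃ λ a′ → π ⟨$⟩ˡ e a ≡ e a′) →
    {F : Subset m} {F′ : Subset n} → IsFixingSet G F → (∀ {a} → a ∈ F → e a ∈ F′) →
    (∀ i → i ∈ F′ → π ⟨$⟩ʳ i ≡ i) → ∀ a → π ⟨$⟩ʳ e a ≡ e a
  fixed-on-image π π-aut forth back {F} fixes F⊆F′ π-fixes a =
    trans (π↾σ a) (cong e (σ-identity a))
    where
    σ : Permutation′ m
    σ = proj₁ (restriction π e e-injective forth back)
    π↾σ : Restricts π e σ
    π↾σ = proj₂ (restriction π e e-injective forth back)
    σ-fixes : ∀ a → a ∈ F → σ ⟨$⟩ʳ a ≡ a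
    σ-fixes a a∈F = e-injective (trans (sym (π↾σ a)) (π-fixes (e a) (F⊆F′ a∈F)))
    σ-identity : IsIdentity σ
    σ-identity = fixes σ (restriction-automorphism {π} {σ} π↾σ π-aut) σ-fixes

degree : Graph n → Fin n → ℕ
degree G v = sum (λ j → if adj G v j then 1 else 0)

module _ (G : Graph n) (π : Permutation′ n) (π-aut : IsAutomorphism G π) where

  degree-invariant : ∀ v → degree G (π ⟨$⟩ʳ v) ≡ degree G v
  degree-invariant v = trans (sum-permute (λ j → if adj G (π ⟨$⟩ʳ v) j then 1 else 0) π)
    (sum-cong-≗ (λ j → cong (λ b → if b then 1 else 0) (π-aut v j)))

  degree-invariant⁻¹ : ∀ v → degree G (π ⟨$⟩ˡ v) ≡ degree G v
  degree-invariant⁻¹ v =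
    trans (sym (degree-invariant (π ⟨$⟩ˡ v))) (cong (degree G) (inverseʳ π))

SidesSeparated : Graph n₁ → Graph n₂ → Set
SidesSeparated {n₁} {n₂} G₁ G₂ =
  ∀ a b → degree (join G₁ G₂) (a ↑ˡ n₂) ≢ degree (join G₁ G₂) (n₁ ↑ʳ b)

module _ (G₁ : Graph n₁) (G₂ : Graph n₂) (separated : SidesSeparated G₁ G₂) where

  private
    J : Graph (n₁ + n₂)
    J = join G₁ G₂

  leftByDegree : ∀ a v → degree J v ≡ degree J (a ↑ˡ n₂) → ∃ λ a′ → v ≡ a′ ↑ˡ n₂
  leftByDegree a v same with side n₁ n₂ v
  ... | left a′ = a′ , refl
  ... | right b = ⊥-elim (separated a b (sym same))

  rightByDegree : ∀ b v → degree J v ≡ degree J (n₁ ↑ʳ b) → ∃ λ b′ → v ≡ n₁ ↑ʳ b′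
  rightByDegree b v same with side n₁ n₂ v
  ... | left a  = ⊥-elim (separated a b same)
  ... | right b′ = b′ , refl

  join-fixingSet : {F₁ : Subset n₁} {F₂ : Subset n₂} →
    IsFixingSet G₁ F₁ → IsFixingSet G₂ F₂ → IsFixingSet J (F₁ ++ F₂)
  join-fixingSet {F₁} {F₂} fixes₁ fixes₂ π π-aut π-fixes i with side n₁ n₂ i
  ... | left a = fixed-on-image G₁ J (_↑ˡ n₂) (join-adj-ll G₁ G₂) (↑ˡ-injective n₂ _ _) π π-aut
    (λ a → leftByDegree a _ (degree-invariant J π π-aut (a ↑ˡ n₂)))
    (λ a → leftByDegree a _ (degree-invariant⁻¹ J π π-aut (a ↑ˡ n₂)))
    fixes₁ (∈-++ˡ⁺ F₁ F₂) π-fixes a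
  ... | right b = fixed-on-image G₂ J (n₁ ↑ʳ_) (join-adj-rr G₁ G₂) (↑ʳ-injective n₁ _ _) π π-aut
    (λ b → rightByDegree b _ (degree-invariant J π π-aut (n₁ ↑ʳ b)))
    (λ b → rightByDegree b _ (degree-invariant⁻¹ J π π-aut (n₁ ↑ʳ b)))
    fixes₂ (∈-++ʳ⁺ F₁ F₂) π-fixes b

fixingSet-nonempty : (G : Graph n) → Symmetric G → ∀ F → IsFixingSet G F → 1 ≤ ∣ F ∣
fixingSet-nonempty G (σ , σ-aut , σ≢id) F fixes = n≢0⇒n>0 λ ∣F∣≡0 →
  σ≢id (fixes σ σ-aut λ i i∈F → case subst (1 ≤_) ∣F∣≡0 (∈⇒1≤∣p∣ i∈F) of λ ())

fixNumber-one : (G : Graph n) → Symmetric G →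
  (F : Subset n) → IsFixingSet G F → ∣ F ∣ ≡ 1 → IsFixNumber G 1
fixNumber-one G symmetric F fixes ∣F∣≡1 = (F , fixes , ∣F∣≡1) , fixingSet-nonempty G symmetric

fixNumber-join-≥ : (G₁ : Graph n₁) (G₂ : Graph n₂) {k₁ k₂ k : ℕ} →
  IsFixNumber G₁ k₁ → IsFixNumber G₂ k₂ → IsFixNumber (join G₁ G₂) k → k₁ + k₂ ≤ k
fixNumber-join-≥ G₁ G₂ fix₁ fix₂ ((F , fixes , ∣F∣≡k) , _) =
  subst (_ ≤_) ∣F∣≡k (join-fixingSet-lowerBound G₁ G₂ fix₁ fix₂ F fixes)

walk-reverse : (G : Graph n) {i j : Fin n} → Walk G i j → Walk G j i
walk-reverse G = reverseOnto here
  where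
  reverseOnto : ∀ {i j k} → Walk G j i → Walk G j k → Walk G k i
  reverseOnto back here                 = back
  reverseOnto back (step {i = u} u~v w) = reverseOnto (step (trans (Defs.sym G _ u) u~v) back) w

walk-append : (G : Graph n) {i j k : Fin n} → Walk G i j → Walk G j k → Walk G i k
walk-append G here         w′ = w′
walk-append G (step i~u w) w′ = step i~u (walk-append G w w′)

connected-via : (G : Graph n) (r : Fin n) → (∀ i → Walk G i r) → Connected G
connected-via G r toRoot i j = walk-append G (toRoot i) (walk-reverse G (toRoot j))

suc≢ᵇself : ∀ k → (suc k ≡ᵇ k) ≡ false
suc≢ᵇself zero    = refl
suc≢ᵇself (suc k) = suc≢ᵇself k

path : ∀ n → Graph n
path n = record
  { adj    = consecutive
  ; sym    = λ i j → ∨-comm (suc (toℕ i) ≡ᵇ toℕ j) _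
  ; irrefl = λ i → cong₂ _∨_ (suc≢ᵇself (toℕ i)) (suc≢ᵇself (toℕ i))
  }
  where
  consecutive : Fin n → Fin n → Bool
  consecutive i j = (suc (toℕ i) ≡ᵇ toℕ j) ∨ (suc (toℕ j) ≡ᵇ toℕ i)

automorphism? : (G : Graph n) (π : Permutation′ n) → Dec (IsAutomorphism G π)
automorphism? G π = all? λ i → all? λ j → adj G (π ⟨$⟩ʳ i) (π ⟨$⟩ʳ j) Bool.≟ adj G i j

image-clash : (π : Permutation′ n) {u v w : Fin n} → π ⟨$⟩ʳ u ≡ w → π ⟨$⟩ʳ v ≡ w → u ≡ v
image-clash π πu≡w πv≡w = ⟨$⟩ʳ-injective π (trans πu≡w (sym πv≡w))

image-adj : (G : Graph n) (π : Permutation′ n) → IsAutomorphism G π → {u v w x : Fin n} →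
  π ⟨$⟩ʳ u ≡ w → π ⟨$⟩ʳ v ≡ x → adj G w x ≡ adj G u v
image-adj G π π-aut {u} {v} πu≡w πv≡x =
  trans (cong₂ (adj G) (sym πu≡w) (sym πv≡x)) (π-aut u v)

K₂ : Graph 2
K₂ = path 2

P₄ : Graph 4
P₄ = path 4

K₂-connected : Connected K₂
K₂-connected = connected-via K₂ 0F λ where
  0F → here
  1F → step refl here

P₄-connected : Connected P₄
P₄-connected = connected-via P₄ 0F λ where
  0F → here
  1F → step refl here
  2F → step {j = 1F} refl (step refl here)
  3F → step {j = 2F} refl (step {j = 1F} refl (step refl here))

K₂-symmetric : Symmetric K₂
K₂-symmetric = reverse , from-yes (automorphism? K₂ reverse) , λ reverse-id → case reverse-id 0F of λ ()

P₄-symmetric : Symmetric P₄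
P₄-symmetric = reverse , from-yes (automorphism? P₄ reverse) , λ reverse-id → case reverse-id 0F of λ ()

K₂-end : Subset 2
K₂-end = ⁅ 0F ⁆

P₄-end : Subset 4
P₄-end = ⁅ 0F ⁆

K₂-fixedByEnd : IsFixingSet K₂ K₂-end
K₂-fixedByEnd π π-aut π-fixes = fixed
  where
  at0 : π ⟨$⟩ʳ 0F ≡ 0F
  at0 = π-fixes 0F here
  at1 : π ⟨$⟩ʳ 1F ≡ 1F
  at1 with π ⟨$⟩ʳ 1F in e
  ... | 0F = case image-clash π e at0 of λ ()
  ... | 1F = refl
  fixed : IsIdentity π
  fixed 0F = at0
  fixed 1F = at1

P₄-fixedByEnd : IsFixingSet P₄ P₄-end
P₄-fixedByEnd π π-aut π-fixes = fixed
  where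
  at0 : π ⟨$⟩ʳ 0F ≡ 0F
  at0 = π-fixes 0F here
  at1 : π ⟨$⟩ʳ 1F ≡ 1F
  at1 with π ⟨$⟩ʳ 1F in e
  ... | 0F = case image-clash π e at0 of λ ()
  ... | 1F = refl
  ... | 2F = case image-adj P₄ π π-aut at0 e of λ ()
  ... | 3F = case image-adj P₄ π π-aut at0 e of λ ()
  at2 : π ⟨$⟩ʳ 2F ≡ 2F
  at2 with π ⟨$⟩ʳ 2F in e
  ... | 0F = case image-clash π e at0 of λ ()
  ... | 1F = case image-clash π e at1 of λ ()
  ... | 2F = refl
  ... | 3F = case image-adj P₄ π π-aut at1 e of λ ()
  at3 : π ⟨$⟩ʳ 3F ≡ 3F
  at3 with π ⟨$⟩ʳ 3F in e
  ... | 0F = case image-clash π e at0 of λ ()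
  ... | 1F = case image-clash π e at1 of λ ()
  ... | 2F = case image-clash π e at2 of λ ()
  ... | 3F = refl
  fixed : IsIdentity π
  fixed 0F = at0
  fixed 1F = at1
  fixed 2F = at2
  fixed 3F = at3

-- In K₂ + P₄ the vertices of K₂ have degree 5, those of P₄ degree 3 or 4.
K₂+P₄-separated : SidesSeparated K₂ P₄
K₂+P₄-separated = from-yes (all? {n = 2} λ a → all? {n = 4} λ b →
  ¬? (degree (join K₂ P₄) (a ↑ˡ 4) ℕ.≟ degree (join K₂ P₄) (2 ↑ʳ b)))

fix-K₂ : IsFixNumber K₂ 1
fix-K₂ = fixNumber-one K₂ K₂-symmetric K₂-end K₂-fixedByEnd refl

fix-P₄ : IsFixNumber P₄ 1
fix-P₄ = fixNumber-one P₄ P₄-symmetric P₄-end P₄-fixedByEnd refl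

fix-K₂+P₄ : IsFixNumber (join K₂ P₄) (1 + 1)
fix-K₂+P₄ =
  (K₂-end ++ P₄-end , join-fixingSet K₂ P₄ K₂+P₄-separated K₂-fixedByEnd P₄-fixedByEnd , refl) ,
  join-fixingSet-lowerBound K₂ P₄ fix-K₂ fix-P₄

mainTheorem2 :
    ((n₁ n₂ : ℕ) (G₁ : Graph n₁) (G₂ : Graph n₂) →
      Connected G₁ → Connected G₂ → Symmetric G₁ → Symmetric G₂ →
      (k₁ k₂ k : ℕ) → IsFixNumber G₁ k₁ → IsFixNumber G₂ k₂ →
      IsFixNumber (join G₁ G₂) k → k₁ + k₂ ≤ k)
    ×
    (Σ ℕ λ n₁ → Σ ℕ λ n₂ → Σ (Graph n₁) λ G₁ → Σ (Graph n₂) λ G₂ →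
      Connected G₁ × Connected G₂ × Symmetric G₁ × Symmetric G₂ ×
      (Σ ℕ λ k₁ → Σ ℕ λ k₂ →
        IsFixNumber G₁ k₁ × IsFixNumber G₂ k₂ ×
        IsFixNumber (join G₁ G₂) (k₁ + k₂)))
mainTheorem2 =
  -- the lower bound holds for all graphs, connected and symmetric or not
  (λ _ _ G₁ G₂ _ _ _ _ _ _ _ → fixNumber-join-≥ G₁ G₂) ,
  (2 , 4 , K₂ , P₄ , K₂-connected , P₄-connected , K₂-symmetric , P₄-symmetric ,
   1 , 1 , fix-K₂ , fix-P₄ , fix-K₂+P₄)
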